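{- In the setting described in the context, assume that $\mathcal{I}$ is a $(k,k+1)$-instance with the small-arity constraints added. Let $l\le k$, let $\mathbb{P}$ be an $l$-tree and let $F$ be a face of $\mathbb{P}$. Then every assignment $\alpha:F\to A$ that is consistent with the labeling and satisfies $F$ extends to a realization of $\mathbb{P}$. In particular, every $l$-tree is realizable.
   Context: Standing setting: $k\ge2$; either $\mathcal{V}$ is a variety with a $(k+2)$-ary near unanimity term, or $\mathbf{A}$ is an idempotent algebra with local near unanimity term operations of arity $k+2$. $\mathcal{I}=(V,(\mathbf{A}_x)_{x\in V},(R_S)_{S\subseteq V,|S|\le k})$, where $V$ is a finite set of variables, each $\mathbf{A}_x$ is in $\mathcal{V}$ (resp. an isomorphic copy of $\mathbf{A}$), the universes $A_x$ are pairwise disjoint, $A=\bigcup_x A_x$, each $R_S$ is a subuniverse of $\prod_{x\in S}\mathbf{A}_x$ (elements viewed as maps $r:S\to A$ with $r(x)\in A_x$), and for $S'\subseteq S$ the restriction of $R_S$ to $S'$ is contained in $R_{S'}$. "$(k,k+1)$-instance with the small-arity constraints added" means: for every $(k+1)$-element $W\subseteq V$, every $k$-element $S\subseteq W$ and every $f\in R_S$ there is $g:W\to A$ extending $f$ with $g|_T\in R_T$ for all $k$-element $T\subseteq W$; and for $|S'|<k$, $R_{S'}$ equals the restriction of $R_S$ to $S'$ for any $k$-element $S\supseteq S'$. For variables $x_1,\dots,x_m$ ($m\le k$, not necessarily distinct), $R_{x_1,\dots,x_m}=\{(r(x_1),\dots,r(x_m)):r\in R_{\{x_1,\dots,x_m\}}\}$.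 A pattern is $\mathbb{P}=(P;\mathcal{F},v)$ with $P$ a set of vertices, $\mathcal{F}$ a family of subsets of $P$ of size at most $k$ closed under subsets (faces), and $v:P\to V$ a labeling. An assignment $\alpha$ on vertices is consistent with the labeling if $\alpha(i)\in A_{v(i)}$; it satisfies a set $\{f_1,\dots,f_m\}$ ($m\le k$) if $(\alpha(f_1),\dots,\alpha(f_m))\in R_{v(f_1),\dots,v(f_m)}$. A realization of $\mathbb{P}$ is a consistent $\alpha:P\to A$ satisfying every face. A subpattern has a subset of vertices, a subfamily of faces (closed under subsets) and the restricted labeling; a complete pattern has all subsets of size $\le k$ as faces. For $l\le k$ and a set $F$ of at most $l$ labeled vertices: the complete $l$-tree with base $F$ of depth 1 is the complete pattern on $F$; that of depth $d+1$ is obtained from that of depth $d$, $\mathbb{T}$, by adding, for every face $E$ of $\mathbb{T}$ and every $(l+1-|E|)$-element set $U\subseteq V$ of variables, a set $G$ of $|U|$ fresh vertices labeled bijectively by $U$, together with all subsets of $E\cup G$ of size at most $k$ as faces. An $l$-tree is a subpattern of a complete $l$-tree. -}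

module Defs where

open import Level using () renaming (suc to lsuc)
open import Data.Nat using (ℕ; zero; suc; _+_; _∸_; _≤_; _<_)
open import Data.Bool using (Bool; true; false; T; if_then_else_)
open import Data.Fin using (Fin; splitAt) renaming (zero to fz; suc to fs)
open import Data.Fin.Properties using (any?) renaming (_≟_ to _≟F_)
open import Data.Fin.Subset using (Subset; ∣_∣)
open import Data.Vec using (Vec; []; _∷_; lookup; tabulate)
open import Data.List using (List)
open import Data.List.Membership.Propositional using () renaming (_∈_ to _∈L_)
open import Data.Product using (Σ; Σ-syntax; ∃; ∃-syntax; _×_; _,_; proj₁; proj₂)
open import Data.Sum using (_⊎_; inj₁; inj₂)
open import Function using (_∘_)
open import Function.Definitions using (Injective)
open import Relation.Nullary using (does)
open import Relation.Nullary.Decidable using (⌊_⌋)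
open import Relation.Binary.PropositionalEquality using (_≡_)

-- Subsets of Fin m (stdlib 'Subset m' = Vec Bool m, size ∣_∣ from stdlib).
-- Membership is taken as  T (lookup S x)  (definitionally proof-irrelevant).

_∈ˢ_ : ∀ {m} → Fin m → Subset m → Set
x ∈ˢ S = T (lookup S x)

_⊆ˢ_ : ∀ {m} → Subset m → Subset m → Set
S ⊆ˢ S' = ∀ x → x ∈ˢ S → x ∈ˢ S'

members : ∀ {m} (X : Subset m) → Fin ∣ X ∣ → Fin m
members (true ∷ X) fz = fz
members (true ∷ X) (fs i) = fs (members X i)
members (false ∷ X) i = fs (members X i)

members-∈ : ∀ {m} (X : Subset m) (i : Fin ∣ X ∣) → members X i ∈ˢ X
members-∈ (true ∷ X) fz = _
members-∈ (true ∷ X) (fs i) = members-∈ X i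
members-∈ (false ∷ X) i = members-∈ X i

img : ∀ {m n} → (Fin m → Fin n) → Subset n
img xs = tabulate (λ y → ⌊ any? (λ i → xs i ≟F y) ⌋)

record Signature : Set₁ where
  field
    Op : Set
    ar : Op → ℕ
open Signature public

record Algebra (𝑆 : Signature) : Set₁ where
  field
    Carrier : Set
    ⟦_⟧ : (o : Op 𝑆) → (Fin (ar 𝑆 o) → Carrier) → Carrier
open Algebra public

data Term (𝑆 : Signature) (m : ℕ) : Set where
  var : Fin m → Term 𝑆 m
  app : (o : Op 𝑆) → (Fin (ar 𝑆 o) → Term 𝑆 m) → Term 𝑆 m

eval : ∀ {𝑆 m} (A : Algebra 𝑆) → Term 𝑆 m → (Fin m → Carrier A) → Carrier A
eval A (var i) ρ = ρ i
eval A (app o ts) ρ = ⟦ A ⟧ o (λ j → eval A (ts j) ρ)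

nuTuple : ∀ {C : Set} {m} → Fin m → C → C → Fin m → C
nuTuple i x y j = if ⌊ j ≟F i ⌋ then y else x

NUon : ∀ {𝑆 m} (A : Algebra 𝑆) → Term 𝑆 m → Carrier A → Carrier A → Set
NUon A t x y = ∀ i → eval A t (nuTuple i x y) ≡ x

IsNU : ∀ {𝑆 m} (A : Algebra 𝑆) → Term 𝑆 m → Set
IsNU A t = ∀ x y → NUon A t x y

Idempotent : ∀ {𝑆} → Algebra 𝑆 → Set
Idempotent {𝑆} A = ∀ (o : Op 𝑆) (a : Carrier A) → ⟦ A ⟧ o (λ _ → a) ≡ a

LocalNU : ∀ {𝑆} → ℕ → Algebra 𝑆 → Set
LocalNU {𝑆} m A = ∀ (X : List (Carrier A)) → Σ[ t ∈ Term 𝑆 m ]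
  (∀ x y → x ∈L X → y ∈L X → NUon A t x y)

record _≅_ {𝑆} (A B : Algebra 𝑆) : Set where
  field
    to   : Carrier A → Carrier B
    from : Carrier B → Carrier A
    to-from : ∀ b → to (from b) ≡ b
    from-to : ∀ a → from (to a) ≡ a
    hom : ∀ o (as : Fin (ar 𝑆 o) → Carrier A) → to (⟦ A ⟧ o as) ≡ ⟦ B ⟧ o (to ∘ as)

-- Instances.  Variables V = Fin n.  An element of R_S is a map r : S → A
-- with r(x) ∈ A_x, i.e. a dependent function on the members of S.

record Instance (𝑆 : Signature) (n : ℕ) : Set₁ where
  field
    alg : Fin n → Algebra 𝑆
    -- R S is only used / constrained for ∣ S ∣ ≤ k
    R   : (S : Subset n) → ((x : Fin n) → x ∈ˢ S → Carrier (alg x)) → Set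
    -- R_S is a set of (extensional) maps
    R-ext : ∀ S r r' → (∀ x p → r x p ≡ r' x p) → R S r → R S r'
open Instance public

module _ {𝑆 : Signature} {n : ℕ} (I : Instance 𝑆 n) where

  Tup : Subset n → Set
  Tup S = (x : Fin n) → x ∈ˢ S → Carrier (alg I x)

  restrict : ∀ S' S → S' ⊆ˢ S → Tup S → Tup S'
  restrict S' S h r x p = r x (h x p)

  record WellFormed (k : ℕ) : Set where
    field
      subuniverse : ∀ S → ∣ S ∣ ≤ k → ∀ (o : Op 𝑆) (rs : Fin (ar 𝑆 o) → Tup S) →
        (∀ j → R I S (rs j)) → R I S (λ x p → ⟦ alg I x ⟧ o (λ j → rs j x p))
      restriction : ∀ S S' → ∣ S ∣ ≤ k → (h : S' ⊆ˢ S) → ∀ r →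
        R I S r → R I S' (restrict S' S h r)

  record KK1 (k : ℕ) : Set where
    field
      extend : ∀ W S → ∣ W ∣ ≡ suc k → ∣ S ∣ ≡ k → (h : S ⊆ˢ W) → ∀ f → R I S f →
        Σ[ g ∈ Tup W ] ((∀ x p → g x (h x p) ≡ f x p) ×
          (∀ T → ∣ T ∣ ≡ k → (h' : T ⊆ˢ W) → R I T (restrict T W h' g)))
      small : ∀ S' S → ∣ S' ∣ < k → ∣ S ∣ ≡ k → (h : S' ⊆ˢ S) → ∀ f →
        (R I S' f → Σ[ r ∈ Tup S ] (R I S r × (∀ x p → r x (h x p) ≡ f x p))) ×
        (Σ[ r ∈ Tup S ] (R I S r × (∀ x p → r x (h x p) ≡ f x p)) → R I S' f)

  Rvars : ∀ {m} (xs : Fin m → Fin n) → ((i : Fin m) → Carrier (alg I (xs i))) → Set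
  Rvars xs a = Σ[ r ∈ Tup (img xs) ] (R I (img xs) r ×
                 (∀ i (p : xs i ∈ˢ img xs) → r (xs i) p ≡ a i))

  Setting : ℕ → Set₁
  Setting k = (Σ[ t ∈ Term 𝑆 (suc (suc k)) ] (∀ x → IsNU (alg I x) t))
            ⊎ (Σ[ A ∈ Algebra 𝑆 ] (Idempotent A × LocalNU (suc (suc k)) A ×
                 (∀ x → alg I x ≅ A)))

-- Patterns.  A face is given by an injective enumeration of its vertices.

record Pattern (n k : ℕ) : Set₁ where
  field
    Vtx  : Set
    lab  : Vtx → Fin n
    Face : Set
    size : Face → ℕ
    elem : (f : Face) → Fin (size f) → Vtx
    elem-inj : ∀ f → Injective _≡_ _≡_ (elem f)
    size≤k   : ∀ f → size f ≤ k
    -- closed under subsets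
    closed : ∀ f (X : Subset (size f)) → Σ[ g ∈ Face ] (∀ v →
      ((Σ[ j ∈ Fin (size g) ] elem g j ≡ v) → Σ[ i ∈ Fin (size f) ] (i ∈ˢ X × elem f i ≡ v)) ×
      ((Σ[ i ∈ Fin (size f) ] (i ∈ˢ X × elem f i ≡ v)) → Σ[ j ∈ Fin (size g) ] elem g j ≡ v))
open Pattern public

module _ {𝑆 : Signature} {n k : ℕ} (I : Instance 𝑆 n) (P : Pattern n k) where

  -- assignments consistent with the labeling
  Assignment : Set
  Assignment = (i : Vtx P) → Carrier (alg I (lab P i))

  SatisfiesFace : (f : Face P) → ((i : Fin (size P f)) → Carrier (alg I (lab P (elem P f i)))) → Set
  SatisfiesFace f a = Rvars I (lab P ∘ elem P f) a

  Realization : Assignment → Set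
  Realization α = ∀ f → SatisfiesFace f (λ i → α (elem P f i))

record Tree (n : ℕ) : Set₁ where
  field
    TV  : Set
    tlab : TV → Fin n
    TF  : Set
    tsize : TF → ℕ
    telem : (f : TF) → Fin (tsize f) → TV
open Tree public

module _ (n k l : ℕ) where

  base : (b : ℕ) → (Fin b → Fin n) → Tree n
  base b β = record
    { TV = Fin b ; tlab = β
    ; TF = Σ[ X ∈ Subset b ] ∣ X ∣ ≤ k
    ; tsize = λ f → ∣ proj₁ f ∣
    ; telem = λ f → members (proj₁ f) }

  Attach : Tree n → Set
  Attach T = Σ[ E ∈ TF T ] Σ[ U ∈ Subset n ] ∣ U ∣ ≡ suc l ∸ tsize T E

  -- new faces: subsets of E ∪ G (size ≤ k) containing at least one fresh
  -- vertex (subsets of E are already faces of T)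
  NewFace : (T : Tree n) → Attach T → Set
  NewFace T (E , U , _) = Σ[ XE ∈ Subset (tsize T E) ] Σ[ XU ∈ Subset n ]
    (XU ⊆ˢ U × 0 < ∣ XU ∣ × ∣ XE ∣ + ∣ XU ∣ ≤ k)

  step : Tree n → Tree n
  step T = record
    { TV = TV T ⊎ (Σ[ a ∈ Attach T ] Σ[ x ∈ Fin n ] x ∈ˢ proj₁ (proj₂ a))
    ; tlab = tl
    ; TF = TF T ⊎ Σ (Attach T) (NewFace T)
    ; tsize = ts
    ; telem = te }
    where
      tl : TV T ⊎ (Σ[ a ∈ Attach T ] Σ[ x ∈ Fin n ] x ∈ˢ proj₁ (proj₂ a)) → Fin n
      tl (inj₁ v) = tlab T v
      tl (inj₂ (_ , x , _)) = x
      ts : TF T ⊎ Σ (Attach T) (NewFace T) → ℕ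
      ts (inj₁ f) = tsize T f
      ts (inj₂ (_ , XE , XU , _)) = ∣ XE ∣ + ∣ XU ∣
      te : (f : TF T ⊎ Σ (Attach T) (NewFace T)) → Fin (ts f) →
           TV T ⊎ (Σ[ a ∈ Attach T ] Σ[ x ∈ Fin n ] x ∈ˢ proj₁ (proj₂ a))
      te (inj₁ f) i = inj₁ (telem T f i)
      te (inj₂ ((E , U , e) , XE , XU , sub , _)) i with splitAt ∣ XE ∣ i
      ... | inj₁ i' = inj₁ (telem T E (members XE i'))
      ... | inj₂ j = inj₂ ((E , U , e) , members XU j , sub _ (members-∈ XU j))

  -- complete l-tree with base (b, β) of depth d+1
  complete : (b : ℕ) → (Fin b → Fin n) → ℕ → Tree n
  complete b β zero = base b β
  complete b β (suc d) = step (complete b β d)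

  -- P is an l-tree: (isomorphic to) a subpattern of a complete l-tree
  IsLTree : Pattern n k → Set
  IsLTree P = Σ[ b ∈ ℕ ] Σ[ β ∈ (Fin b → Fin n) ] Σ[ d ∈ ℕ ] (b ≤ l ×
    (let T = complete b β d in
     Σ[ ι ∈ (Vtx P → TV T) ] (Injective _≡_ _≡_ ι ×
       (∀ v → tlab T (ι v) ≡ lab P v) ×
       (∀ f → Σ[ g ∈ TF T ] (∀ w →
          ((Σ[ j ∈ Fin (tsize T g) ] telem T g j ≡ w) → Σ[ i ∈ Fin (size P f) ] ι (elem P f i) ≡ w) ×
          ((Σ[ i ∈ Fin (size P f) ] ι (elem P f i) ≡ w) → Σ[ j ∈ Fin (tsize T g) ] telem T g j ≡ w))))))

-- A complete l-tree is built in layers: each layer attaches, to a face E of the previous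
-- one, fresh vertices for a set U of variables, and |E| + |U| ≤ k + 1.  In a
-- (k, k+1)-instance with the small-arity constraints added, every constraint tuple on at
-- most k variables of a set W of at most k + 1 variables extends to a map on W all of whose
-- restrictions to at most k variables are constraint tuples.  Hence every realization of a
-- layer extends to the next layer, attachment by attachment.  To realize the tree from a
-- given face F, induct on the depth: if F is an old face, realize the previous layer from
-- F; if F was attached to E together with U, first extend α to the variables of E and U,
-- realize the previous layer from the restriction of this extension to E, and use the
-- extension itself for the fresh vertices attached with F.

module Submission where

open import Defs
open import Data.Nat using (ℕ; _≤_)
open import Data.Fin using (Fin)
open import Data.Product using (Σ-syntax; _×_)
open import Relation.Binary.PropositionalEquality using (_≡_)

open import Data.Nat using (zero; suc; _+_; _∸_; _≤?_; z≤n; s≤s; s≤s⁻¹)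
open import Data.Nat.Properties using (≤-trans; ≤-reflexive; ≤-antisym; ≤-total; ≰⇒>; n≤1+n; m≤n⇒m≤1+n; 1+n≰n)
open import Data.Nat.Properties using (+-suc; +-monoˡ-≤; +-identityʳ; m+[n∸m]≡n; m≤n⇒m∸n≡0)
open import Data.Bool using (true; false; T)
open import Data.Bool.Properties using (T-irrelevant; T-≡)
import Data.Bool.Properties as Bool
open import Data.Fin using (splitAt) renaming (zero to fz; suc to fs)
open import Data.Fin.Properties using () renaming (_≟_ to _≟F_)
open import Data.Fin.Subset using (Subset; ∣_∣; _∪_; ⊥; ⊤; ⁅_⁆) renaming (_∈_ to _∈ᵇ_)
open import Data.Fin.Subset.Properties using (∈⊤; ∉⊥; x∈⁅x⁆; x∈p∪q⁺; p⊆q⇒∣p∣≤∣q∣; ∣⁅x⁆∣≡1; ∣⊥∣≡0; ∣⊤∣≡n)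
open import Data.Vec using (_∷_; []; lookup)
open import Data.Vec.Properties using (lookup∘tabulate; lookup⇒[]=; []=⇒lookup)
import Data.Vec.Properties as Vec
open import Data.List using (List; length; map; tabulate) renaming (lookup to lookupL)
import Data.List.Properties as List
open import Data.List.Properties using (length-map; length-tabulate)
open import Data.List.Relation.Unary.All using (All; all?) renaming (lookup to lookupAll)
open import Data.List.Relation.Unary.All.Properties using () renaming (tabulate⁺ to all-tabulate⁺)
open import Data.List.Relation.Unary.Any using (index)
open import Data.List.Relation.Unary.Any.Properties using (lookup-index)
open import Data.List.Membership.Propositional using (_∈_)
open import Data.List.Membership.Propositional.Properties using (∈-lookup; ∈-map⁺; ∈-map⁻; ∈-tabulate⁺; ∈-tabulate⁻)
open import Data.List.Membership.DecPropositional using () renaming (_∈?_ to member?)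
open import Data.Product using (Σ; _,_; proj₁; proj₂)
open import Data.Product.Properties using (Σ-≡,≡→≡)
import Data.Product.Properties as Product
open import Data.Sum using (_⊎_; inj₁; inj₂; [_,_]′)
import Data.Sum.Properties as Sum
open import Data.Empty using (⊥-elim)
open import Function using (_∘_; _∋_; Equivalence)
open import Relation.Nullary using (Dec; yes; no)
open import Relation.Nullary.Decidable using (_×-dec_; T?; fromWitness; toWitness)
open import Relation.Binary.Definitions using (DecidableEquality)
open import Relation.Binary.PropositionalEquality using (refl; sym; trans; cong; cong₂; subst)

⊆ˢ-refl : ∀ {m} (X : Subset m) → X ⊆ˢ X
⊆ˢ-refl X x p = p

⊆ˢ-trans : ∀ {m} (X Y Z : Subset m) → X ⊆ˢ Y → Y ⊆ˢ Z → X ⊆ˢ Z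
⊆ˢ-trans X Y Z h h′ x p = h′ x (h x p)

s⊆ˢs : ∀ {m} b (X Y : Subset m) → X ⊆ˢ Y → (b ∷ X) ⊆ˢ (b ∷ Y)
s⊆ˢs b X Y h fz p = p
s⊆ˢs b X Y h (fs x) p = h x p

out⊆ˢ : ∀ {m} b (X Y : Subset m) → X ⊆ˢ Y → (false ∷ X) ⊆ˢ (b ∷ Y)
out⊆ˢ b X Y h (fs x) p = h x p

∈ˢ⇒∈ : ∀ {m} {x : Fin m} (S : Subset m) → x ∈ˢ S → x ∈ᵇ S
∈ˢ⇒∈ {x = x} S p = lookup⇒[]= x S (Equivalence.to T-≡ p)

∈⇒∈ˢ : ∀ {m} {x : Fin m} {S : Subset m} → x ∈ᵇ S → x ∈ˢ S
∈⇒∈ˢ p = Equivalence.from T-≡ ([]=⇒lookup p)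

⊆ˢ⇒∣∣≤ : ∀ {m} (X Y : Subset m) → X ⊆ˢ Y → ∣ X ∣ ≤ ∣ Y ∣
⊆ˢ⇒∣∣≤ X Y h = p⊆q⇒∣p∣≤∣q∣ {p = X} {q = Y} (λ p → ∈ˢ⇒∈ Y (h _ (∈⇒∈ˢ p)))

⊆ˢ∧∣∣≥⇒≡ : ∀ {m} (X Y : Subset m) → X ⊆ˢ Y → ∣ Y ∣ ≤ ∣ X ∣ → X ≡ Y
⊆ˢ∧∣∣≥⇒≡ [] [] h le = refl
⊆ˢ∧∣∣≥⇒≡ (true ∷ X) (true ∷ Y) h le = cong (true ∷_) (⊆ˢ∧∣∣≥⇒≡ X Y (h ∘ fs) (s≤s⁻¹ le))
⊆ˢ∧∣∣≥⇒≡ (false ∷ X) (false ∷ Y) h le = cong (false ∷_) (⊆ˢ∧∣∣≥⇒≡ X Y (h ∘ fs) le)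
⊆ˢ∧∣∣≥⇒≡ (true ∷ X) (false ∷ Y) h le = ⊥-elim (h fz _)
⊆ˢ∧∣∣≥⇒≡ (false ∷ X) (true ∷ Y) h le = ⊥-elim (1+n≰n (≤-trans le (⊆ˢ⇒∣∣≤ X Y (h ∘ fs))))

∈ˢ-⊤ : ∀ {m} (x : Fin m) → x ∈ˢ ⊤
∈ˢ-⊤ {m} x = ∈⇒∈ˢ {S = ⊤ {m}} (∈⊤ {x = x})

⊥⊆ˢ : ∀ {m} (X : Subset m) → ⊥ ⊆ˢ X
⊥⊆ˢ X x p = ⊥-elim (∉⊥ {x = x} (∈ˢ⇒∈ ⊥ p))

∈ˢ-∪⁺ : ∀ {m} (X Y : Subset m) {x} → x ∈ˢ X ⊎ x ∈ˢ Y → x ∈ˢ (X ∪ Y)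
∈ˢ-∪⁺ X Y (inj₁ p) = ∈⇒∈ˢ {S = X ∪ Y} (x∈p∪q⁺ (inj₁ (∈ˢ⇒∈ X p)))
∈ˢ-∪⁺ X Y (inj₂ p) = ∈⇒∈ˢ {S = X ∪ Y} (x∈p∪q⁺ (inj₂ (∈ˢ⇒∈ Y p)))

∣p∪q∣≤∣p∣+∣q∣ : ∀ {m} (X Y : Subset m) → ∣ X ∪ Y ∣ ≤ ∣ X ∣ + ∣ Y ∣
∣p∪q∣≤∣p∣+∣q∣ [] [] = z≤n
∣p∪q∣≤∣p∣+∣q∣ (true ∷ X) (false ∷ Y) = s≤s (∣p∪q∣≤∣p∣+∣q∣ X Y)
∣p∪q∣≤∣p∣+∣q∣ (true ∷ X) (true ∷ Y) =
  s≤s (≤-trans (m≤n⇒m≤1+n (∣p∪q∣≤∣p∣+∣q∣ X Y)) (≤-reflexive (sym (+-suc ∣ X ∣ ∣ Y ∣))))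
∣p∪q∣≤∣p∣+∣q∣ (false ∷ X) (true ∷ Y) =
  ≤-trans (s≤s (∣p∪q∣≤∣p∣+∣q∣ X Y)) (≤-reflexive (sym (+-suc ∣ X ∣ ∣ Y ∣)))
∣p∪q∣≤∣p∣+∣q∣ (false ∷ X) (false ∷ Y) = ∣p∪q∣≤∣p∣+∣q∣ X Y

interpolate : ∀ {m} (X Y : Subset m) c → X ⊆ˢ Y → ∣ X ∣ ≤ c → c ≤ ∣ Y ∣ →
  Σ[ Z ∈ Subset m ] (X ⊆ˢ Z × Z ⊆ˢ Y × ∣ Z ∣ ≡ c)
interpolate [] [] zero h lo hi = [] , ⊆ˢ-refl [] , ⊆ˢ-refl [] , refl
interpolate [] [] (suc c) h lo ()
interpolate (true ∷ X) (true ∷ Y) zero h () hi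
interpolate (true ∷ X) (true ∷ Y) (suc c) h (s≤s lo) (s≤s hi) =
  let Z , X⊆Z , Z⊆Y , ∣Z∣ = interpolate X Y c (h ∘ fs) lo hi
  in true ∷ Z , s⊆ˢs true X Z X⊆Z , s⊆ˢs true Z Y Z⊆Y , cong suc ∣Z∣
interpolate (true ∷ X) (false ∷ Y) c h lo hi = ⊥-elim (h fz _)
interpolate (false ∷ X) (false ∷ Y) c h lo hi =
  let Z , X⊆Z , Z⊆Y , ∣Z∣ = interpolate X Y c (h ∘ fs) lo hi
  in false ∷ Z , out⊆ˢ false X Z X⊆Z , out⊆ˢ false Z Y Z⊆Y , ∣Z∣
interpolate (false ∷ X) (true ∷ Y) c h lo hi with c ≤? ∣ Y ∣
... | yes c≤∣Y∣ =
  let Z , X⊆Z , Z⊆Y , ∣Z∣ = interpolate X Y c (h ∘ fs) lo c≤∣Y∣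
  in false ∷ Z , out⊆ˢ false X Z X⊆Z , out⊆ˢ true Z Y Z⊆Y , ∣Z∣
... | no c≰∣Y∣ = true ∷ Y , out⊆ˢ true X Y (h ∘ fs) , ⊆ˢ-refl (true ∷ Y) , ≤-antisym (≰⇒> c≰∣Y∣) hi

∈-img : ∀ {m n} (xs : Fin m → Fin n) i → xs i ∈ˢ img xs
∈-img xs i = subst T (sym (lookup∘tabulate _ (xs i))) (fromWitness (i , refl))

∈-img⁻ : ∀ {m n} (xs : Fin m → Fin n) {y} → y ∈ˢ img xs → Σ[ i ∈ Fin m ] xs i ≡ y
∈-img⁻ xs {y} p = toWitness (subst T (lookup∘tabulate _ y) p)

img-⊆ : ∀ {m n} (xs : Fin m → Fin n) (S : Subset n) → (∀ i → xs i ∈ˢ S) → img xs ⊆ˢ S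
img-⊆ xs S h y p = let i , e = ∈-img⁻ xs p in subst (_∈ˢ S) e (h i)

∣img∣≤ : ∀ {m n} (xs : Fin m → Fin n) → ∣ img xs ∣ ≤ m
∣img∣≤ {zero} {n} xs = ≤-trans (⊆ˢ⇒∣∣≤ (img xs) ⊥ (img-⊆ xs ⊥ λ ())) (≤-reflexive (∣⊥∣≡0 n))
∣img∣≤ {suc m} xs = ≤-trans (⊆ˢ⇒∣∣≤ (img xs) (head ∪ tail) (img-⊆ xs (head ∪ tail) cases))
  (≤-trans (∣p∪q∣≤∣p∣+∣q∣ head tail)
    (subst (λ c → c + ∣ tail ∣ ≤ suc m) (sym (∣⁅x⁆∣≡1 (xs fz))) (s≤s (∣img∣≤ (xs ∘ fs)))))
  where
  head tail : Subset _
  head = ⁅ xs fz ⁆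
  tail = img (xs ∘ fs)
  cases : ∀ i → xs i ∈ˢ (head ∪ tail)
  cases fz = ∈ˢ-∪⁺ head tail (inj₁ (∈⇒∈ˢ (x∈⁅x⁆ (xs fz))))
  cases (fs i) = ∈ˢ-∪⁺ head tail (inj₂ (∈-img (xs ∘ fs) i))

_⊆ᵢ_ : ∀ {A : Set} {m m′} → (Fin m → A) → (Fin m′ → A) → Set
f ⊆ᵢ g = ∀ i → Σ[ j ∈ _ ] g j ≡ f i

⊆ᵢ-map : ∀ {A B : Set} {m m′} (h : A → B) {f : Fin m → A} {g : Fin m′ → A} → f ⊆ᵢ g → (h ∘ f) ⊆ᵢ (h ∘ g)
⊆ᵢ-map h f⊆g i = let j , e = f⊆g i in j , cong h e

img-mono : ∀ {m m′ n} (xs : Fin m → Fin n) (ys : Fin m′ → Fin n) → xs ⊆ᵢ ys → img xs ⊆ˢ img ys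
img-mono xs ys xs⊆ys = img-⊆ xs (img ys) λ i → let j , e = xs⊆ys i in subst (_∈ˢ img ys) e (∈-img ys j)

img-cong : ∀ {m m′ n} (xs : Fin m → Fin n) (ys : Fin m′ → Fin n) → xs ⊆ᵢ ys → ys ⊆ᵢ xs → img xs ≡ img ys
img-cong xs ys xs⊆ys ys⊆xs =
  ⊆ˢ∧∣∣≥⇒≡ (img xs) (img ys) (img-mono xs ys xs⊆ys) (⊆ˢ⇒∣∣≤ (img ys) (img xs) (img-mono ys xs ys⊆xs))

⊆ᵢ-respˡ : ∀ {A : Set} {m m′} {f f′ : Fin m → A} {g : Fin m′ → A} → (∀ i → f i ≡ f′ i) → f ⊆ᵢ g → f′ ⊆ᵢ g
⊆ᵢ-respˡ f≡f′ f⊆g i = let j , e = f⊆g i in j , trans e (f≡f′ i)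

⊆ᵢ-respʳ : ∀ {A : Set} {m m′} {f : Fin m → A} {g g′ : Fin m′ → A} → (∀ j → g j ≡ g′ j) → f ⊆ᵢ g → f ⊆ᵢ g′
⊆ᵢ-respʳ g≡g′ f⊆g i = let j , e = f⊆g i in j , trans (sym (g≡g′ j)) e

⊆ᵢ-trans : ∀ {A : Set} {m m′ m″} {f : Fin m → A} {g : Fin m′ → A} {h : Fin m″ → A} →
  f ⊆ᵢ g → g ⊆ᵢ h → f ⊆ᵢ h
⊆ᵢ-trans f⊆g g⊆h i = let j , e = f⊆g i; j′ , e′ = g⊆h j in j′ , trans e′ e

∈⇒⊆ᵢ-lookup : ∀ {A : Set} {m} (f : Fin m → A) (vs : List A) → (∀ i → f i ∈ vs) → f ⊆ᵢ lookupL vs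
∈⇒⊆ᵢ-lookup f vs f∈vs i = index (f∈vs i) , sym (lookup-index (f∈vs i))

∈⇒lookup-⊆ᵢ : ∀ {A : Set} {m} (vs : List A) (f : Fin m → A) →
  (∀ {w} → w ∈ vs → Σ[ j ∈ Fin m ] f j ≡ w) → lookupL vs ⊆ᵢ f
∈⇒lookup-⊆ᵢ vs f vs⊆f i = vs⊆f (∈-lookup {xs = vs} i)

map∘lookup-⊆ᵢ : ∀ {A B : Set} (g : A → B) (vs : List A) → (g ∘ lookupL vs) ⊆ᵢ lookupL (map g vs)
map∘lookup-⊆ᵢ g vs = ∈⇒⊆ᵢ-lookup (g ∘ lookupL vs) (map g vs) λ i → ∈-map⁺ g (∈-lookup {xs = vs} i)

lookup∘map-⊆ᵢ : ∀ {A B : Set} (g : A → B) (vs : List A) → lookupL (map g vs) ⊆ᵢ (g ∘ lookupL vs)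
lookup∘map-⊆ᵢ g vs = ∈⇒lookup-⊆ᵢ (map g vs) (g ∘ lookupL vs) λ w∈ →
  let v , v∈ , e = ∈-map⁻ g w∈ in index v∈ , trans (cong g (sym (lookup-index v∈))) (sym e)

∈-img∘lookup : ∀ {A : Set} {n} (f : A → Fin n) {vs : List A} {w} → w ∈ vs → f w ∈ˢ img (f ∘ lookupL vs)
∈-img∘lookup f {vs} w∈ =
  subst (_∈ˢ img (f ∘ lookupL vs)) (cong f (sym (lookup-index w∈))) (∈-img (f ∘ lookupL vs) (index w∈))

img∘lookup-⊆ : ∀ {A : Set} {n} (f : A → Fin n) (vs : List A) (S : Subset n) →
  (∀ {w} → w ∈ vs → f w ∈ˢ S) → img (f ∘ lookupL vs) ⊆ˢ S
img∘lookup-⊆ f vs S h = img-⊆ (f ∘ lookupL vs) S (λ i → h (∈-lookup {xs = vs} i))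

Val : ∀ {𝑆 n} → Instance 𝑆 n → Fin n → Set
Val I x = Carrier (alg I x)

Entry : ∀ {𝑆 n} → Instance 𝑆 n → Set
Entry {n = n} I = Σ (Fin n) (Val I)

module _ {𝑆 : Signature} {n : ℕ} (I : Instance 𝑆 n) where

  entries : ∀ {m} (xs : Fin m → Fin n) → (∀ i → Val I (xs i)) → Fin m → Entry I
  entries xs a i = xs i , a i

  tuple-irrelevant : ∀ S (r : Tup I S) {x} (p q : x ∈ˢ S) → r x p ≡ r x q
  tuple-irrelevant S r p q = cong (r _) (T-irrelevant p q)

  R-subst : ∀ {S S′} → S ≡ S′ → ∀ r → R I S r →
    Σ[ r′ ∈ Tup I S′ ] (R I S′ r′ × (∀ x p q → r′ x p ≡ r x q))
  R-subst {S} refl r Rr = r , Rr , λ x → tuple-irrelevant S r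

  tuple-entry : ∀ S (r : Tup I S) {x y} {a : Val I x} {b : Val I y} (p : x ∈ˢ S) (q : y ∈ˢ S) →
    (Entry I ∋ (x , a)) ≡ (y , b) → r x p ≡ a → r y q ≡ b
  tuple-entry S r p q refl rp≡a = trans (tuple-irrelevant S r q p) rp≡a

  Rvars-cong : ∀ {m m′} (xs : Fin m → Fin n) (a : ∀ i → Val I (xs i))
    (ys : Fin m′ → Fin n) (b : ∀ j → Val I (ys j)) →
    entries xs a ⊆ᵢ entries ys b → entries ys b ⊆ᵢ entries xs a → Rvars I xs a → Rvars I ys b
  Rvars-cong xs a ys b xa⊆yb yb⊆xa (r , Rr , r≡a) =
    let r′ , Rr′ , r′≡r = R-subst (img-cong xs ys (⊆ᵢ-map proj₁ xa⊆yb) (⊆ᵢ-map proj₁ yb⊆xa)) r Rr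
    in r′ , Rr′ , λ j p →
      let i , e = yb⊆xa j
          q = ∈-img xs i
      in trans (r′≡r (ys j) p (subst (_∈ˢ img xs) (cong proj₁ e) q)) (tuple-entry (img xs) r q _ e (r≡a i q))

module Extension {𝑆 : Signature} {n k : ℕ} (I : Instance 𝑆 n)
  (wf : WellFormed I k) (kk : KK1 I k) (k≤n : k ≤ n) where

  Solution : (W : Subset n) → Tup I W → Set
  Solution W g = ∀ T → (h : T ⊆ˢ W) → ∣ T ∣ ≤ k → R I T (restrict I T W h g)

  R⇒solution : ∀ S r → ∣ S ∣ ≤ k → R I S r → Solution S r
  R⇒solution S r ∣S∣≤k Rr T h _ = WellFormed.restriction wf S T ∣S∣≤k h r Rr

  restrict-solution : ∀ W W′ (h : W′ ⊆ˢ W) g → Solution W g → Solution W′ (restrict I W′ W h g)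
  restrict-solution W W′ h g sol T h′ = sol T (⊆ˢ-trans T W′ W h′ h)

  solution-from-k-subsets : ∀ W g → k ≤ ∣ W ∣ →
    (∀ T → ∣ T ∣ ≡ k → (h : T ⊆ˢ W) → R I T (restrict I T W h g)) → Solution W g
  solution-from-k-subsets W g k≤∣W∣ Rg T h ∣T∣≤k =
    let T′ , T⊆T′ , T′⊆W , ∣T′∣≡k = interpolate T W k h ∣T∣≤k k≤∣W∣
    in R-ext I T _ _ (λ x p → tuple-irrelevant I W g _ _)
         (R⇒solution T′ _ (≤-reflexive ∣T′∣≡k) (Rg T′ ∣T′∣≡k T′⊆W) T T⊆T′ ∣T∣≤k)

  Rvars-solution : ∀ W g → Solution W g → ∀ {m} (xs : Fin m → Fin n) (a : ∀ i → Val I (xs i)) → m ≤ k →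
    (xs∈W : ∀ i → xs i ∈ˢ W) → (∀ i → g (xs i) (xs∈W i) ≡ a i) → Rvars I xs a
  Rvars-solution W g sol xs a m≤k xs∈W g≡a =
    restrict I (img xs) W (img-⊆ xs W xs∈W) g , sol (img xs) _ (≤-trans (∣img∣≤ xs) m≤k) ,
    λ i p → trans (tuple-irrelevant I W g _ _) (g≡a i)

  k≤∣⊤∣ : k ≤ ∣ ⊤ {n} ∣
  k≤∣⊤∣ = ≤-trans k≤n (≤-reflexive (sym (∣⊤∣≡n n)))

  lift : ∀ S′ S (h : S′ ⊆ˢ S) → ∣ S ∣ ≡ k → ∀ r → R I S′ r →
    Σ[ r′ ∈ Tup I S ] (R I S r′ × (∀ x p → r′ x (h x p) ≡ r x p))
  lift S′ S h ∣S∣≡k r Rr with suc ∣ S′ ∣ ≤? k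
  ... | yes ∣S′∣<k = proj₁ (KK1.small kk S′ S ∣S′∣<k ∣S∣≡k h r) Rr
  ... | no ∣S′∣≮k with ⊆ˢ∧∣∣≥⇒≡ S′ S h (≤-trans (≤-reflexive ∣S∣≡k) (s≤s⁻¹ (≰⇒> ∣S′∣≮k)))
  ...   | refl = r , Rr , λ x p → tuple-irrelevant I S r _ _

  extend : ∀ W → ∣ W ∣ ≤ suc k → ∀ S (h : S ⊆ˢ W) → ∣ S ∣ ≤ k → ∀ r → R I S r →
    Σ[ g ∈ Tup I W ] (Solution W g × (∀ x p → g x (h x p) ≡ r x p))
  extend W ∣W∣≤1+k S h ∣S∣≤k r Rr with ∣ W ∣ ≤? k
  ... | yes ∣W∣≤k =
    let S₀ , W⊆S₀ , _ , ∣S₀∣≡k = interpolate W ⊤ k (λ x _ → ∈ˢ-⊤ x) ∣W∣≤k k≤∣⊤∣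
        r₀ , Rr₀ , r₀≡r = lift S S₀ (⊆ˢ-trans S W S₀ h W⊆S₀) ∣S₀∣≡k r Rr
    in restrict I W S₀ W⊆S₀ r₀ ,
       restrict-solution S₀ W W⊆S₀ r₀ (R⇒solution S₀ r₀ (≤-reflexive ∣S₀∣≡k) Rr₀) , r₀≡r
  ... | no ∣W∣≰k =
    let ∣W∣≡1+k = ≤-antisym ∣W∣≤1+k (≰⇒> ∣W∣≰k)
        k≤∣W∣ = ≤-trans (n≤1+n k) (≤-reflexive (sym ∣W∣≡1+k))
        S₁ , S⊆S₁ , S₁⊆W , ∣S₁∣≡k = interpolate S W k h ∣S∣≤k k≤∣W∣
        r₁ , Rr₁ , r₁≡r = lift S S₁ S⊆S₁ ∣S₁∣≡k r Rr
        g , g≡r₁ , Rg = KK1.extend kk W S₁ ∣W∣≡1+k ∣S₁∣≡k S₁⊆W r₁ Rr₁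
    in g , solution-from-k-subsets W g k≤∣W∣ Rg ,
       λ x p → trans (tuple-irrelevant I W g _ _) (trans (g≡r₁ x (S⊆S₁ x p)) (r₁≡r x p))

  inhabited : 1 ≤ k → ∀ S r → ∣ S ∣ ≤ k → R I S r → ∀ x → Val I x
  inhabited 1≤k S r ∣S∣≤k Rr x =
    let S₁ , x∈S₁ , _ , ∣S₁∣≡k =
          interpolate ⁅ x ⁆ ⊤ k (λ y _ → ∈ˢ-⊤ y) (≤-trans (≤-reflexive (∣⁅x⁆∣≡1 x)) 1≤k) k≤∣⊤∣
        r₁ , _ = lift ⊥ S₁ (⊥⊆ˢ S₁) ∣S₁∣≡k _ (WellFormed.restriction wf S ⊥ ∣S∣≤k (⊥⊆ˢ S) r Rr)
    in r₁ x (x∈S₁ x (∈⇒∈ˢ (x∈⁅x⁆ x)))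

-- A copy of the complete trees whose faces have decidable equality, needed to treat the
-- attachment containing F differently from all others.  A new face is an attachment (a
-- face E and a set U of variables) with its list of vertices, each a vertex of E or the
-- fresh vertex of a variable of U.  Nodes exist for all attachments, including invalid
-- ones, so fresh values must be given everywhere; outside the relevant scope they are
-- arbitrary defaults.
module CanonicalTree (n k b : ℕ) (baseLabel : Fin b → Fin n) where

  Node : ℕ → Set
  Simplex : ℕ → Set
  Node zero = Fin b
  Node (suc d) = Node d ⊎ ((Simplex d × Subset n) × Fin n)
  Simplex zero = List (Fin b)
  Simplex (suc d) = Simplex d ⊎ ((Simplex d × Subset n) × List (Node d ⊎ Fin n))

  Attachment : ℕ → Set
  Attachment d = Simplex d × Subset n

  label : ∀ d → Node d → Fin n
  label zero i = baseLabel i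
  label (suc d) (inj₁ c) = label d c
  label (suc d) (inj₂ (_ , x)) = x

  attachNode : ∀ {d} → Attachment d → Node d ⊎ Fin n → Node (suc d)
  attachNode a (inj₁ c) = inj₁ c
  attachNode a (inj₂ x) = inj₂ (a , x)

  nodes : ∀ d → Simplex d → List (Node d)
  nodes zero s = s
  nodes (suc d) (inj₁ s) = map inj₁ (nodes d s)
  nodes (suc d) (inj₂ (a , its)) = map (attachNode a) its

  vars : ∀ d → Simplex d → Subset n
  vars d s = img (label d ∘ lookupL (nodes d s))

  scope : ∀ d → Attachment d → Subset n
  scope d (s , U) = vars d s ∪ U

  ≟-Node : ∀ d → DecidableEquality (Node d)
  ≟-Simplex : ∀ d → DecidableEquality (Simplex d)
  ≟-Attachment : ∀ d → DecidableEquality (Attachment d)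
  ≟-Node zero = _≟F_
  ≟-Node (suc d) = Sum.≡-dec (≟-Node d) (Product.≡-dec (≟-Attachment d) _≟F_)
  ≟-Simplex zero = List.≡-dec _≟F_
  ≟-Simplex (suc d) =
    Sum.≡-dec (≟-Simplex d) (Product.≡-dec (≟-Attachment d) (List.≡-dec (Sum.≡-dec (≟-Node d) _≟F_)))
  ≟-Attachment d = Product.≡-dec (≟-Simplex d) (Vec.≡-dec Bool._≟_)

  Within : ∀ d → Attachment d → Node d ⊎ Fin n → Set
  Within d (s , U) (inj₁ c) = c ∈ nodes d s
  Within d (s , U) (inj₂ x) = x ∈ˢ U

  Valid : ∀ d → Simplex d → Set
  ValidAttachment : ∀ d → Attachment d → Set
  Valid zero s = length s ≤ k
  Valid (suc d) (inj₁ s) = Valid d s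
  Valid (suc d) (inj₂ (a , its)) = ValidAttachment d a × length its ≤ k × All (Within d a) its
  ValidAttachment d (s , U) = Valid d s × length (nodes d s) + ∣ U ∣ ≤ suc k

  within? : ∀ d a t → Dec (Within d a t)
  within? d (s , U) (inj₁ c) = member? (≟-Node d) c (nodes d s)
  within? d (s , U) (inj₂ x) = T? (lookup U x)

  valid? : ∀ d s → Dec (Valid d s)
  validAttachment? : ∀ d a → Dec (ValidAttachment d a)
  valid? zero s = length s ≤? k
  valid? (suc d) (inj₁ s) = valid? d s
  valid? (suc d) (inj₂ (a , its)) = validAttachment? d a ×-dec (length its ≤? k ×-dec all? (within? d a) its)
  validAttachment? d (s , U) = valid? d s ×-dec (length (nodes d s) + ∣ U ∣ ≤? suc k)

  length-nodes≤k : ∀ d s → Valid d s → length (nodes d s) ≤ k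
  length-nodes≤k zero s v = v
  length-nodes≤k (suc d) (inj₁ s) v = ≤-trans (≤-reflexive (length-map inj₁ (nodes d s))) (length-nodes≤k d s v)
  length-nodes≤k (suc d) (inj₂ (a , its)) (_ , len , _) = ≤-trans (≤-reflexive (length-map (attachNode a) its)) len

  ∣vars∣≤k : ∀ d s → Valid d s → ∣ vars d s ∣ ≤ k
  ∣vars∣≤k d s v = ≤-trans (∣img∣≤ (label d ∘ lookupL (nodes d s))) (length-nodes≤k d s v)

  ∣scope∣≤1+k : ∀ d a → ValidAttachment d a → ∣ scope d a ∣ ≤ suc k
  ∣scope∣≤1+k d (s , U) (_ , bound) =
    ≤-trans (∣p∪q∣≤∣p∣+∣q∣ (vars d s) U)
      (≤-trans (+-monoˡ-≤ ∣ U ∣ (∣img∣≤ (label d ∘ lookupL (nodes d s)))) bound)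

  vars⊆scope : ∀ d s U → vars d s ⊆ˢ scope d (s , U)
  vars⊆scope d s U x p = ∈ˢ-∪⁺ (vars d s) U (inj₁ p)

  label∈scope : ∀ d a {t} → Within d a t → label (suc d) (attachNode a t) ∈ˢ scope d a
  label∈scope d (s , U) {inj₁ c} c∈s = vars⊆scope d s U _ (∈-img∘lookup (label d) c∈s)
  label∈scope d (s , U) {inj₂ x} x∈U = ∈ˢ-∪⁺ (vars d s) U (inj₂ x∈U)

  vars-inj₁ : ∀ d s → vars d s ≡ vars (suc d) (inj₁ s)
  vars-inj₁ d s = img-cong _ _ (⊆ᵢ-map (label (suc d)) (map∘lookup-⊆ᵢ inj₁ (nodes d s)))
    (⊆ᵢ-map (label (suc d)) (lookup∘map-⊆ᵢ inj₁ (nodes d s)))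

module TreeRealization {𝑆 : Signature} {n k : ℕ} (I : Instance 𝑆 n)
  (wf : WellFormed I k) (kk : KK1 I k) (k≤n : k ≤ n)
  {b : ℕ} (baseLabel : Fin b → Fin n) (b≤k : b ≤ k) (default : ∀ x → Val I x) where

  open CanonicalTree n k b baseLabel
  open Extension I wf kk k≤n

  Assign : ℕ → Set
  Assign d = (c : Node d) → Val I (label d c)

  entry : ∀ {d} → Assign d → Node d → Entry I
  entry {d} β c = label d c , β c

  Sat : ∀ d → Assign d → List (Node d) → Set
  Sat d β vs = Rvars I (label d ∘ lookupL vs) (β ∘ lookupL vs)

  Realizes : ∀ d → Assign d → Set
  Realizes d β = ∀ s → Valid d s → Sat d β (nodes d s)

  Extends : ∀ d → Assign d → List (Node d) → ∀ S → Tup I S → Set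
  Extends d β vs S r = ∀ w → w ∈ vs → ∀ p → β w ≡ r (label d w) p

  RealizableFrom : ∀ d → Simplex d → Set
  RealizableFrom d s = Valid d s → ∀ r → R I (vars d s) r →
    Σ[ β ∈ Assign d ] (Realizes d β × Extends d β (nodes d s) (vars d s) r)

  Realizable : ℕ → Set
  Realizable d = ∀ s → RealizableFrom d s

  sat-extends : ∀ d β vs (sat : Sat d β vs) → Extends d β vs (img (label d ∘ lookupL vs)) (proj₁ sat)
  sat-extends d β vs (r , _ , r≡β) w w∈ p =
    let i = index w∈
        q = ∈-img (label d ∘ lookupL vs) i
    in sym (tuple-entry I (img (label d ∘ lookupL vs)) r q p (cong (entry β) (sym (lookup-index w∈))) (r≡β i q))

  Fresh : ℕ → Set
  Fresh d = Attachment d → ∀ x → Val I x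

  _⊕_ : ∀ {d} → Assign d → Fresh d → Assign (suc d)
  (β ⊕ Ψ) (inj₁ c) = β c
  (β ⊕ Ψ) (inj₂ (a , x)) = Ψ a x

  FillsAt : ∀ d → Assign d → Attachment d → (∀ x → Val I x) → Set
  FillsAt d β a φ =
    Solution (scope d a) (λ x _ → φ x) × (∀ w → w ∈ nodes d (proj₁ a) → β w ≡ φ (label d w))

  Fills : ∀ d → Assign d → Fresh d → Set
  Fills d β Ψ = ∀ a → ValidAttachment d a → FillsAt d β a (Ψ a)

  totalize : ∀ W → Tup I W → ∀ x → Val I x
  totalize W γ x with T? (lookup W x)
  ... | yes p = γ x p
  ... | no _ = default x

  totalize-≡ : ∀ W γ x p → totalize W γ x ≡ γ x p
  totalize-≡ W γ x p with T? (lookup W x)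
  ... | yes q = tuple-irrelevant I W γ q p
  ... | no ¬p = ⊥-elim (¬p p)

  fillsAt-totalize : ∀ d β a γ → Solution (scope d a) γ → Extends d β (nodes d (proj₁ a)) (scope d a) γ →
    FillsAt d β a (totalize (scope d a) γ)
  fillsAt-totalize d β (s , U) γ sol β≡γ =
    (λ T h ∣T∣≤k → R-ext I T (restrict I T W h γ) _ (λ x p → sym (totalize-≡ W γ x (h x p))) (sol T h ∣T∣≤k)) ,
    λ w w∈ → let p = vars⊆scope d s U _ (∈-img∘lookup (label d) w∈)
             in trans (β≡γ w w∈ p) (sym (totalize-≡ W γ _ p))
    where
    W : Subset n
    W = scope d (s , U)

  fill : ∀ d β → Realizes d β → Σ[ Ψ ∈ Fresh d ] Fills d β Ψ
  fill d β sat = (λ a → choose a (validAttachment? d a)) , λ a va → choose-fills a va (validAttachment? d a)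
    where
    extension : ∀ s U → ValidAttachment d (s , U) →
      Σ[ γ ∈ Tup I (scope d (s , U)) ] (Solution (scope d (s , U)) γ × Extends d β (nodes d s) (scope d (s , U)) γ)
    extension s U (vs , bound) =
      let r , Rr , _ = sat s vs
          γ , sol , γ≡r = extend (scope d (s , U)) (∣scope∣≤1+k d (s , U) (vs , bound))
                            (vars d s) (vars⊆scope d s U) (∣vars∣≤k d s vs) r Rr
      in γ , sol , λ w w∈ p →
        let q = ∈-img∘lookup (label d) w∈
        in trans (sat-extends d β (nodes d s) (sat s vs) w w∈ q)
             (trans (sym (γ≡r _ q)) (tuple-irrelevant I (scope d (s , U)) γ _ p))
    choose : ∀ a → Dec (ValidAttachment d a) → ∀ x → Val I x
    choose (s , U) (yes va) = totalize (scope d (s , U)) (proj₁ (extension s U va))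
    choose a (no _) = default
    choose-fills : ∀ a → ValidAttachment d a → (v? : Dec (ValidAttachment d a)) → FillsAt d β a (choose a v?)
    choose-fills (s , U) _ (yes va) =
      let γ , sol , β≡γ = extension s U va in fillsAt-totalize d β (s , U) γ sol β≡γ
    choose-fills a va (no ¬va) = ⊥-elim (¬va va)

  override : ∀ d β Ψ → Fills d β Ψ → ∀ a φ → FillsAt d β a φ →
    Σ[ Ψ′ ∈ Fresh d ] (Fills d β Ψ′ × Ψ′ a ≡ φ)
  override d β Ψ fills a φ fillsφ = (λ a′ → choose a′ (≟-Attachment d a′ a)) ,
    (λ a′ va′ → choose-fills a′ va′ (≟-Attachment d a′ a)) , choose-self (≟-Attachment d a a)
    where
    choose : ∀ a′ → Dec (a′ ≡ a) → ∀ x → Val I x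
    choose a′ (yes _) = φ
    choose a′ (no _) = Ψ a′
    choose-fills : ∀ a′ → ValidAttachment d a′ → (eq? : Dec (a′ ≡ a)) → FillsAt d β a′ (choose a′ eq?)
    choose-fills a′ va′ (yes refl) = fillsφ
    choose-fills a′ va′ (no _) = fills a′ va′
    choose-self : (eq? : Dec (a ≡ a)) → choose a eq? ≡ φ
    choose-self (yes _) = refl
    choose-self (no a≢a) = ⊥-elim (a≢a refl)

  attached-label : ∀ d a its → All (Within d a) its →
    ∀ {w} → w ∈ map (attachNode a) its → label (suc d) w ∈ˢ scope d a
  attached-label d a its within w∈ with ∈-map⁻ (attachNode a) w∈
  ... | t , t∈ , refl = label∈scope d a {t} (lookupAll within t∈)

  attached-value : ∀ d β Ψ a its → All (Within d a) its → FillsAt d β a (Ψ a) →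
    ∀ {w} → w ∈ map (attachNode a) its → (β ⊕ Ψ) w ≡ Ψ a (label (suc d) w)
  attached-value d β Ψ a its within (_ , β≡Ψ) w∈ with ∈-map⁻ (attachNode a) w∈
  ... | inj₁ c , t∈ , refl = β≡Ψ c (lookupAll within t∈)
  ... | inj₂ x , t∈ , refl = refl

  realizes-⊕ : ∀ d β Ψ → Realizes d β → Fills d β Ψ → Realizes (suc d) (β ⊕ Ψ)
  realizes-⊕ d β Ψ sat fills (inj₁ s) vs =
    Rvars-cong I _ _ _ _ (⊆ᵢ-map (entry (β ⊕ Ψ)) (map∘lookup-⊆ᵢ inj₁ (nodes d s)))
      (⊆ᵢ-map (entry (β ⊕ Ψ)) (lookup∘map-⊆ᵢ inj₁ (nodes d s))) (sat s vs)
  realizes-⊕ d β Ψ sat fills (inj₂ (a , its)) (va , len , within) =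
    Rvars-solution (scope d a) (λ x _ → Ψ a x) (proj₁ (fills a va)) _ _
      (≤-trans (≤-reflexive (length-map (attachNode a) its)) len)
      (λ i → attached-label d a its within (∈-lookup i))
      (λ i → sym (attached-value d β Ψ a its within (fills a va) (∈-lookup i)))

  realizable-base : Realizable zero
  realizable-base s vs r Rr =
    let g , sol , g≡r = extend W (m≤n⇒m≤1+n (≤-trans (∣img∣≤ baseLabel) b≤k)) (vars zero s)
                          (img∘lookup-⊆ baseLabel s W (λ {w} _ → ∈-img baseLabel w)) (∣vars∣≤k zero s vs) r Rr
        β : Assign zero
        β i = g (baseLabel i) (∈-img baseLabel i)
    in β , (λ s′ vs′ → Rvars-solution W g sol _ _ vs′ (λ i → ∈-img baseLabel (lookupL s′ i)) (λ i → refl)) ,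
       λ w w∈ p → trans (tuple-irrelevant I W g _ _) (g≡r _ p)
    where
    W : Subset n
    W = img baseLabel

  extends-map-inj₁ : ∀ d β Ψ vs S r → Extends d β vs S r → Extends (suc d) (β ⊕ Ψ) (map inj₁ vs) S r
  extends-map-inj₁ d β Ψ vs S r β≡r w w∈ with ∈-map⁻ inj₁ w∈
  ... | v , v∈ , refl = β≡r v v∈

  realizable-old : ∀ d → Realizable d → ∀ s → RealizableFrom (suc d) (inj₁ s)
  realizable-old d realizable-d s vs r Rr =
    let r′ , Rr′ , r′≡r = R-subst I (sym (vars-inj₁ d s)) r Rr
        β , sat , β≡r′ = realizable-d s vs r′ Rr′
        Ψ , fills = fill d β sat
    in β ⊕ Ψ , realizes-⊕ d β Ψ sat fills , extends-map-inj₁ d β Ψ (nodes d s) (vars (suc d) (inj₁ s)) r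
         λ w w∈ p → let q = ∈-img∘lookup (label d) w∈ in trans (β≡r′ w w∈ q) (r′≡r _ q p)

  realizable-new : ∀ d → Realizable d → ∀ a its → RealizableFrom (suc d) (inj₂ (a , its))
  realizable-new d realizable-d (s , U) its valid@((vs , bound) , _ , within) r Rr =
    let γ , solγ , γ≡r = extend W (∣scope∣≤1+k d (s , U) (vs , bound))
                           (vars (suc d) face) new⊆W (∣vars∣≤k (suc d) face valid) r Rr
        β , sat , β≡γ = realizable-d s vs (restrict I (vars d s) W (vars⊆scope d s U) γ)
                          (solγ _ (vars⊆scope d s U) (∣vars∣≤k d s vs))
        Ψ₀ , fills₀ = fill d β sat
        Ψ , fills , Ψ≡γ = override d β Ψ₀ fills₀ (s , U) (totalize W γ) (fillsAt-totalize d β (s , U) γ solγ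
          λ w w∈ p → trans (β≡γ w w∈ (∈-img∘lookup (label d) w∈)) (tuple-irrelevant I W γ _ p))
    in β ⊕ Ψ , realizes-⊕ d β Ψ sat fills , λ w w∈ p →
       trans (attached-value d β Ψ (s , U) its within (fills (s , U) (vs , bound)) w∈)
         (trans (cong (λ φ → φ (label (suc d) w)) Ψ≡γ) (trans (totalize-≡ W γ _ (new⊆W _ p)) (γ≡r _ p)))
    where
    face : Simplex (suc d)
    face = inj₂ ((s , U) , its)
    W : Subset n
    W = scope d (s , U)
    new⊆W : vars (suc d) face ⊆ˢ W
    new⊆W = img∘lookup-⊆ (label (suc d)) (map (attachNode (s , U)) its) W (attached-label d (s , U) its within)

  realizable : ∀ d → Realizable d
  realizable zero = realizable-base
  realizable (suc d) (inj₁ s) = realizable-old d (realizable d) s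
  realizable (suc d) (inj₂ (a , its)) = realizable-new d (realizable d) a its

m+[1+l∸m]≤1+k : ∀ {m l k} → m ≤ k → l ≤ k → m + (suc l ∸ m) ≤ suc k
m+[1+l∸m]≤1+k {m} {l} m≤k l≤k with ≤-total m (suc l)
... | inj₁ m≤1+l = ≤-trans (≤-reflexive (m+[n∸m]≡n m≤1+l)) (s≤s l≤k)
... | inj₂ 1+l≤m =
  ≤-trans (≤-reflexive (trans (cong (m +_) (m≤n⇒m∸n≡0 1+l≤m)) (+-identityʳ m))) (m≤n⇒m≤1+n m≤k)

module Embedding {n k l b : ℕ} (l≤k : l ≤ k) (baseLabel : Fin b → Fin n) where

  open CanonicalTree n k b baseLabel

  tree : ℕ → Tree n
  tree = complete n k l b baseLabel

  toNode : ∀ d → TV (tree d) → Node d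
  toSimplex : ∀ d → TF (tree d) → Simplex d
  newItem : ∀ d (E : TF (tree d)) (XE : Subset (tsize (tree d) E)) (XU : Subset n) →
    Fin (∣ XE ∣ + ∣ XU ∣) → Node d ⊎ Fin n
  toNode zero i = i
  toNode (suc d) (inj₁ v) = inj₁ (toNode d v)
  toNode (suc d) (inj₂ ((E , U , _) , x , _)) = inj₂ ((toSimplex d E , U) , x)
  toSimplex zero (X , _) = tabulate (members X)
  toSimplex (suc d) (inj₁ f) = inj₁ (toSimplex d f)
  toSimplex (suc d) (inj₂ ((E , U , _) , XE , XU , _)) = inj₂ ((toSimplex d E , U) , tabulate (newItem d E XE XU))
  newItem d E XE XU i =
    [ (λ i′ → inj₁ (toNode d (telem (tree d) E (members XE i′)))) , (λ j → inj₂ (members XU j)) ]′ (splitAt ∣ XE ∣ i)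

  label-toNode : ∀ d v → label d (toNode d v) ≡ tlab (tree d) v
  label-toNode zero v = refl
  label-toNode (suc d) (inj₁ v) = label-toNode d v
  label-toNode (suc d) (inj₂ _) = refl

  attachNode-newItem : ∀ d E U e XE XU sub pos le j →
    attachNode (toSimplex d E , U) (newItem d E XE XU j) ≡
      toNode (suc d) (telem (tree (suc d)) (inj₂ ((E , U , e) , XE , XU , sub , pos , le)) j)
  attachNode-newItem d E U e XE XU sub pos le j with splitAt ∣ XE ∣ j
  ... | inj₁ _ = refl
  ... | inj₂ _ = refl

  toNode∈nodes : ∀ d g j → toNode d (telem (tree d) g j) ∈ nodes d (toSimplex d g)
  toNode∈nodes zero (X , _) j = ∈-tabulate⁺ j
  toNode∈nodes (suc d) (inj₁ f) j = ∈-map⁺ inj₁ (toNode∈nodes d f j)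
  toNode∈nodes (suc d) (inj₂ ((E , U , e) , XE , XU , sub , pos , le)) j =
    subst (_∈ nodes (suc d) (toSimplex (suc d) (inj₂ ((E , U , e) , XE , XU , sub , pos , le))))
      (attachNode-newItem d E U e XE XU sub pos le j) (∈-map⁺ (attachNode (toSimplex d E , U)) (∈-tabulate⁺ j))

  ∈nodes⇒toNode : ∀ d g {w} → w ∈ nodes d (toSimplex d g) →
    Σ[ j ∈ Fin (tsize (tree d) g) ] toNode d (telem (tree d) g j) ≡ w
  ∈nodes⇒toNode zero (X , _) w∈ = let j , e = ∈-tabulate⁻ w∈ in j , sym e
  ∈nodes⇒toNode (suc d) (inj₁ f) w∈ with ∈-map⁻ inj₁ w∈
  ... | v , v∈ , refl = let j , e = ∈nodes⇒toNode d f v∈ in j , cong inj₁ e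
  ∈nodes⇒toNode (suc d) (inj₂ ((E , U , e) , XE , XU , sub , pos , le)) w∈
    with ∈-map⁻ (attachNode (toSimplex d E , U)) w∈
  ... | t , t∈ , refl = let j , t≡ = ∈-tabulate⁻ t∈ in
    j , trans (sym (attachNode-newItem d E U e XE XU sub pos le j)) (cong (attachNode (toSimplex d E , U)) (sym t≡))

  length-nodes-toSimplex : ∀ d g → length (nodes d (toSimplex d g)) ≡ tsize (tree d) g
  length-nodes-toSimplex zero (X , _) = length-tabulate (members X)
  length-nodes-toSimplex (suc d) (inj₁ f) =
    trans (length-map inj₁ (nodes d (toSimplex d f))) (length-nodes-toSimplex d f)
  length-nodes-toSimplex (suc d) (inj₂ ((E , U , _) , XE , XU , _)) =
    trans (length-map (attachNode (toSimplex d E , U)) (tabulate (newItem d E XE XU))) (length-tabulate (newItem d E XE XU))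

  tsize≤k : ∀ d g → tsize (tree d) g ≤ k
  tsize≤k zero (X , ∣X∣≤k) = ∣X∣≤k
  tsize≤k (suc d) (inj₁ f) = tsize≤k d f
  tsize≤k (suc d) (inj₂ (_ , _ , _ , _ , _ , size≤k)) = size≤k

  newItem-within : ∀ d E U XE XU → XU ⊆ˢ U → ∀ j → Within d (toSimplex d E , U) (newItem d E XE XU j)
  newItem-within d E U XE XU XU⊆U j with splitAt ∣ XE ∣ j
  ... | inj₁ i = toNode∈nodes d E (members XE i)
  ... | inj₂ i = XU⊆U _ (members-∈ XU i)

  valid-toSimplex : ∀ d g → Valid d (toSimplex d g)
  valid-toSimplex zero (X , ∣X∣≤k) = ≤-trans (≤-reflexive (length-tabulate (members X))) ∣X∣≤k
  valid-toSimplex (suc d) (inj₁ f) = valid-toSimplex d f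
  valid-toSimplex (suc d) (inj₂ ((E , U , ∣U∣≡) , XE , XU , XU⊆U , _ , size≤k)) =
    (valid-toSimplex d E ,
      ≤-trans (≤-reflexive (cong₂ _+_ (length-nodes-toSimplex d E) ∣U∣≡)) (m+[1+l∸m]≤1+k (tsize≤k d E) l≤k)) ,
    ≤-trans (≤-reflexive (length-tabulate (newItem d E XE XU))) size≤k ,
    all-tabulate⁺ (newItem-within d E U XE XU XU⊆U)

  nodes-⊆ᵢ-toNode : ∀ d g → lookupL (nodes d (toSimplex d g)) ⊆ᵢ (toNode d ∘ telem (tree d) g)
  nodes-⊆ᵢ-toNode d g = ∈⇒lookup-⊆ᵢ _ _ (∈nodes⇒toNode d g)

module LTree {n k l : ℕ} (l≤k : l ≤ k) (P : Pattern n k) {b : ℕ} (baseLabel : Fin b → Fin n) (d : ℕ)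
  (ι : Vtx P → TV (complete n k l b baseLabel d))
  (labι : ∀ v → tlab (complete n k l b baseLabel d) (ι v) ≡ lab P v)
  (faceι : ∀ f → Σ[ g ∈ TF (complete n k l b baseLabel d) ] (∀ w →
     ((Σ[ j ∈ Fin (tsize (complete n k l b baseLabel d) g) ] telem (complete n k l b baseLabel d) g j ≡ w) →
        Σ[ i ∈ Fin (size P f) ] ι (elem P f i) ≡ w) ×
     ((Σ[ i ∈ Fin (size P f) ] ι (elem P f i) ≡ w) →
        Σ[ j ∈ Fin (tsize (complete n k l b baseLabel d) g) ] telem (complete n k l b baseLabel d) g j ≡ w)))
  where

  open CanonicalTree n k b baseLabel
  open Embedding l≤k baseLabel

  κ : Vtx P → Node d
  κ = toNode d ∘ ι

  label-κ : ∀ v → label d (κ v) ≡ lab P v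
  label-κ v = trans (label-toNode d (ι v)) (labι v)

  simplexOf : Face P → Simplex d
  simplexOf f = toSimplex d (proj₁ (faceι f))

  valid-simplexOf : ∀ f → Valid d (simplexOf f)
  valid-simplexOf f = valid-toSimplex d (proj₁ (faceι f))

  κ∈nodes : ∀ f i → κ (elem P f i) ∈ nodes d (simplexOf f)
  κ∈nodes f i =
    let j , e = proj₂ (proj₂ (faceι f) (ι (elem P f i))) (i , refl)
    in subst (λ v → toNode d v ∈ nodes d (simplexOf f)) e (toNode∈nodes d (proj₁ (faceι f)) j)

  κ-⊆ᵢ-nodes : ∀ f → (κ ∘ elem P f) ⊆ᵢ lookupL (nodes d (simplexOf f))
  κ-⊆ᵢ-nodes f = ∈⇒⊆ᵢ-lookup _ _ (κ∈nodes f)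

  nodes-⊆ᵢ-κ : ∀ f → lookupL (nodes d (simplexOf f)) ⊆ᵢ (κ ∘ elem P f)
  nodes-⊆ᵢ-κ f = ⊆ᵢ-trans (nodes-⊆ᵢ-toNode d (proj₁ (faceι f)))
    (⊆ᵢ-map (toNode d) λ j → proj₁ (proj₂ (faceι f) (telem (tree d) (proj₁ (faceι f)) j)) (j , refl))

module Pullback {𝑆 : Signature} {n k : ℕ} (I : Instance 𝑆 n) (P : Pattern n k) {V : Set}
  (ℓ : V → Fin n) (κ : Vtx P → V) (ℓκ : ∀ v → ℓ (κ v) ≡ lab P v) where

  pull : ((v : V) → Val I (ℓ v)) → Assignment I P
  pull β v = subst (Val I) (ℓκ v) (β (κ v))

  entry-pull : ∀ β v → (Entry I ∋ (ℓ (κ v) , β (κ v))) ≡ (lab P v , pull β v)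
  entry-pull β v = Σ-≡,≡→≡ (ℓκ v , refl)

  img-pull : ∀ f (vs : List V) → (κ ∘ elem P f) ⊆ᵢ lookupL vs → lookupL vs ⊆ᵢ (κ ∘ elem P f) →
    img (lab P ∘ elem P f) ≡ img (ℓ ∘ lookupL vs)
  img-pull f vs f⊆vs vs⊆f =
    img-cong _ _ (⊆ᵢ-respˡ (ℓκ ∘ elem P f) (⊆ᵢ-map ℓ f⊆vs)) (⊆ᵢ-respʳ (ℓκ ∘ elem P f) (⊆ᵢ-map ℓ vs⊆f))

  satisfies-pull : ∀ β f (vs : List V) → (κ ∘ elem P f) ⊆ᵢ lookupL vs → lookupL vs ⊆ᵢ (κ ∘ elem P f) →
    Rvars I (ℓ ∘ lookupL vs) (β ∘ lookupL vs) → SatisfiesFace I P f (pull β ∘ elem P f)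
  satisfies-pull β f vs f⊆vs vs⊆f = Rvars-cong I _ _ _ _
    (⊆ᵢ-respʳ (entry-pull β ∘ elem P f) (⊆ᵢ-map entryβ vs⊆f))
    (⊆ᵢ-respˡ (entry-pull β ∘ elem P f) (⊆ᵢ-map entryβ f⊆vs))
    where
    entryβ : V → Entry I
    entryβ v = ℓ v , β v

  pull-≡ : ∀ β f α → (sat : SatisfiesFace I P f α) →
    (∀ i p → β (κ (elem P f i)) ≡ proj₁ sat (ℓ (κ (elem P f i))) p) → ∀ i → pull β (elem P f i) ≡ α i
  pull-≡ β f α (r , _ , r≡α) β≡r i =
    let xs∈ = ∈-img (lab P ∘ elem P f) i
        q = subst (_∈ˢ img (lab P ∘ elem P f)) (sym (ℓκ (elem P f i))) xs∈
    in trans (sym (tuple-entry I (img (lab P ∘ elem P f)) r q xs∈ (entry-pull β (elem P f i)) (sym (β≡r i q))))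
         (r≡α i xs∈)

lemma43 : (𝑆 : Signature) (k n : ℕ) → 2 ≤ k → k ≤ n →
    (I : Instance 𝑆 n) → WellFormed I k → Setting I k → KK1 I k →
    (l : ℕ) → l ≤ k → (P : Pattern n k) → IsLTree n k l P →
    (F : Face P) (α : (i : Fin (size P F)) → Carrier (alg I (lab P (elem P F i)))) →
    SatisfiesFace I P F α →
    Σ[ β ∈ Assignment I P ] (Realization I P β × (∀ i → β (elem P F i) ≡ α i))
lemma43 𝑆 k n 2≤k k≤n I wf _ kk l l≤k P (b , baseLabel , d , b≤l , ι , _ , labι , faceι) F α αF@(r₀ , Rr₀ , _) =
  let r , Rr , r≡r₀ = R-subst I (img-pull F (nodes d (simplexOf F)) (κ-⊆ᵢ-nodes F) (nodes-⊆ᵢ-κ F)) r₀ Rr₀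
      β , realizes , β≡r = realizable d (simplexOf F) (valid-simplexOf F) r Rr
  in pull β ,
     (λ f → satisfies-pull β f (nodes d (simplexOf f)) (κ-⊆ᵢ-nodes f) (nodes-⊆ᵢ-κ f)
              (realizes (simplexOf f) (valid-simplexOf f))) ,
     pull-≡ β F α αF (λ i p →
       let q = ∈-img∘lookup (label d) (κ∈nodes F i)
       in trans (β≡r (κ (elem P F i)) (κ∈nodes F i) q) (r≡r₀ _ q p))
  where
  open CanonicalTree n k b baseLabel
  open LTree l≤k P baseLabel d ι labι faceι
  open Extension I wf kk k≤n using (inhabited)
  xs : Fin (size P F) → Fin n
  xs = lab P ∘ elem P F
  default : ∀ x → Val I x
  default = inhabited (≤-trans (s≤s z≤n) 2≤k) (img xs) r₀ (≤-trans (∣img∣≤ xs) (size≤k P F)) Rr₀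
  open TreeRealization I wf kk k≤n baseLabel (≤-trans b≤l l≤k) default
  open Pullback I P (label d) κ label-κ
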